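{- Let $N$ be a positive integer and let $i_1,\dots,i_m$ be integers. The following are equivalent: (1) $NF_n = F_{n+i_1}+F_{n+i_2}+\dots+F_{n+i_m}$ for all integers $n$; (2) $N=\varphi^{i_1}+\varphi^{i_2}+\dots+\varphi^{i_m}$; (3) $NL_n = L_{n+i_1}+L_{n+i_2}+\dots+L_{n+i_m}$ for all integers $n$.
   Context: $\varphi=\frac{1+\sqrt5}{2}$ and $\bar\varphi=\frac{1-\sqrt5}{2}=-\varphi^{ -1}$. For every integer $n$ (including negative $n$), the Fibonacci and Lucas numbers are $F_n=\frac{\varphi^n-\bar\varphi^n}{\sqrt5}$ and $L_n=\varphi^n+\bar\varphi^n$; equivalently $F_0=0,F_1=1$, $L_0=2,L_1=1$, with $X_n=X_{n-1}+X_{n-2}$ for all integers $n$. -}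

module Defs where

open import Data.Nat using (ℕ; zero; suc)
open import Data.Integer using (ℤ; +_; -[1+_]; _+_; _-_; _*_; -_)
open import Data.Product using (_×_; _,_; proj₁)
open import Data.List using (List; map; foldr)

-- Two-sided linear recurrence X_n = X_{n-1} + X_{n-2} on all of ℤ,
-- determined by the seeds X_0 = a and X_1 = b.
-- fwd k = (X_k , X_{k+1});  bwd k = (X_{-k} , X_{-k+1}).
module _ (a b : ℤ) where
  fwd : ℕ → ℤ × ℤ
  fwd zero = a , b
  fwd (suc k) with fwd k
  ... | x , y = y , x + y

  bwd : ℕ → ℤ × ℤ
  bwd zero = a , b
  bwd (suc k) with bwd k
  ... | x , y = y - x , x

  recSeq : ℤ → ℤ
  recSeq (+ k) = proj₁ (fwd k)
  recSeq -[1+ k ] = proj₁ (bwd (suc k))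

F : ℤ → ℤ
F = recSeq (+ 0) (+ 1)

L : ℤ → ℤ
L = recSeq (+ 2) (+ 1)

sumℤ : List ℤ → ℤ
sumℤ = foldr _+_ (+ 0)

-- The subring ℤ[φ] of ℝ: the element  re + im·φ.  Since φ is irrational
-- with minimal polynomial x² - x - 1, two such reals are equal iff their
-- coordinates are equal, so propositional equality of records is real equality.
record ℤφ : Set where
  constructor mkφ
  field
    re : ℤ
    im : ℤ
open ℤφ public

infixl 6 _⊕_
infixl 7 _⊗_

_⊕_ : ℤφ → ℤφ → ℤφ
mkφ a b ⊕ mkφ c d = mkφ (a + c) (b + d)

-- uses φ² = φ + 1
_⊗_ : ℤφ → ℤφ → ℤφ
mkφ a b ⊗ mkφ c d = mkφ (a * c + b * d) (a * d + b * c + b * d)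

one : ℤφ
one = mkφ (+ 1) (+ 0)

zeroφ : ℤφ
zeroφ = mkφ (+ 0) (+ 0)

ι : ℤ → ℤφ
ι n = mkφ n (+ 0)

-- φ and its inverse φ⁻¹ = φ - 1  (indeed φ(φ - 1) = φ² - φ = 1)
φ : ℤφ
φ = mkφ (+ 0) (+ 1)

φ⁻¹ : ℤφ
φ⁻¹ = mkφ (- (+ 1)) (+ 1)

_^ℕ_ : ℤφ → ℕ → ℤφ
x ^ℕ zero = one
x ^ℕ suc k = x ⊗ (x ^ℕ k)

φ^ : ℤ → ℤφ
φ^ (+ k) = φ ^ℕ k
φ^ -[1+ k ] = φ⁻¹ ^ℕ suc k

sumφ : List ℤφ → ℤφ
sumφ = foldr _⊕_ zeroφ

-- Every two-sided sequence X with X (n + 2) = X (n + 1) + X n satisfies the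
-- addition formula X (n + i) = a_i X n + b_i X (n + 1), where φ^i = a_i + b_i φ
-- (both coordinate sequences of φ^i obey the same recurrence, since φ² = φ + 1).
-- Summing over the shifts i₁, …, i_m: with φ^{i₁} + … + φ^{i_m} = A + B φ,
-- the shifted sum equals A X n + B X (n + 1). So N = A + B φ forces the identity
-- N X n = Σ X (n + i) for every such X, and conversely this identity, read at
-- n = 0 and n = 1, pins down A = N and B = 0 as soon as X₀X₂ - X₁² ≠ 0, which
-- is -1 for Fibonacci and 5 for Lucas.
module Submission where

open import Defs
open import Data.Nat using (ℕ; zero; suc; NonZero)
open import Data.Integer using (ℤ; +_; -[1+_]; _+_; _-_; _*_; -_) renaming (suc to sucℤ; NonZero to NonZeroℤ)
open import Data.Integer.Properties using (+-identityʳ; +-comm; *-cancelʳ-≡)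
open import Data.Integer.Tactic.RingSolver using (solve-∀)
open import Data.List using (List; []; _∷_; map)
open import Data.Product using (_×_; _,_; proj₁)
open import Function.Bundles using (_⇔_; mk⇔)
open import Relation.Binary.PropositionalEquality using (_≡_; refl; sym; trans; cong; cong₂; module ≡-Reasoning)

Recurrent : (ℤ → ℤ) → Set
Recurrent X = ∀ n → X (sucℤ (sucℤ n)) ≡ X (sucℤ n) + X n

recurrent-backward : ∀ {X} → Recurrent X → ∀ n → X n ≡ X (sucℤ (sucℤ n)) - X (sucℤ n)
recurrent-backward {X} rec n = trans (cancel (X n) (X (sucℤ n))) (cong (_- X (sucℤ n)) (sym (rec n)))
  where
  cancel : ∀ x y → x ≡ (y + x) - y
  cancel = solve-∀

backward-step : ∀ a b k → proj₁ (bwd a b k) ≡ proj₁ (bwd a b (suc k)) + proj₁ (bwd a b (suc (suc k)))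
backward-step a b k with bwd a b k
... | x , y = undo x y
  where
  undo : ∀ x y → x ≡ (y - x) + (x - (y - x))
  undo = solve-∀

recSeq-recurrent : ∀ a b → Recurrent (recSeq a b)
recSeq-recurrent a b (+ k) with fwd a b k
... | x , y = +-comm x y
recSeq-recurrent a b -[1+ zero ] = undo a b
  where
  undo : ∀ a b → b ≡ a + (b - a)
  undo = solve-∀
recSeq-recurrent a b -[1+ suc zero ] = backward-step a b 0
recSeq-recurrent a b -[1+ suc (suc k) ] = backward-step a b (suc k)

recurrent-unique : ∀ {X Y} → Recurrent X → Recurrent Y →
  X (+ 0) ≡ Y (+ 0) → X (+ 1) ≡ Y (+ 1) → ∀ n → X n ≡ Y n
recurrent-unique {X} {Y} recX recY e₀ e₁ = agree
  where
  upward : ∀ k → X (+ k) ≡ Y (+ k) × X (+ suc k) ≡ Y (+ suc k)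
  upward zero = e₀ , e₁
  upward (suc k) with upward k
  ... | p , q = q , trans (recX (+ k)) (trans (cong₂ _+_ q p) (sym (recY (+ k))))

  step : ∀ m → X (sucℤ m) ≡ Y (sucℤ m) → X (sucℤ (sucℤ m)) ≡ Y (sucℤ (sucℤ m)) → X m ≡ Y m
  step m p q = trans (recurrent-backward recX m)
    (trans (cong₂ _-_ q p) (sym (recurrent-backward recY m)))

  downward : ∀ k → X -[1+ k ] ≡ Y -[1+ k ] × X (sucℤ -[1+ k ]) ≡ Y (sucℤ -[1+ k ])
  downward zero = step -[1+ 0 ] e₀ e₁ , e₀
  downward (suc k) with downward k
  ... | p , q = step -[1+ suc k ] p q , p

  agree : ∀ n → X n ≡ Y n
  agree (+ k) = proj₁ (upward k)
  agree -[1+ k ] = proj₁ (downward k)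

shift-recurrent : ∀ {X} → Recurrent X → ∀ n → Recurrent (λ i → X (n + i))
shift-recurrent {X} rec n i = begin
  X (n + sucℤ (sucℤ i))     ≡⟨ cong X (+-sucℤ n (sucℤ i)) ⟩
  X (sucℤ (n + sucℤ i))     ≡⟨ cong (λ j → X (sucℤ j)) (+-sucℤ n i) ⟩
  X (sucℤ (sucℤ (n + i)))   ≡⟨ rec (n + i) ⟩
  X (sucℤ (n + i)) + X (n + i) ≡⟨ cong (λ j → X j + X (n + i)) (sym (+-sucℤ n i)) ⟩
  X (n + sucℤ i) + X (n + i) ∎
  where
  open ≡-Reasoning
  +-sucℤ : ∀ m j → m + (+ 1 + j) ≡ + 1 + (m + j)
  +-sucℤ = solve-∀

linear-recurrent : ∀ {U V} → Recurrent U → Recurrent V → ∀ a b → Recurrent (λ i → U i * a + V i * b)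
linear-recurrent {U} {V} recU recV a b i =
  trans (cong₂ (λ u v → u * a + v * b) (recU i) (recV i))
        (distrib (U (sucℤ i)) (U i) (V (sucℤ i)) (V i) a b)
  where
  distrib : ∀ u₁ u₀ v₁ v₀ a b → (u₁ + u₀) * a + (v₁ + v₀) * b ≡ (u₁ * a + v₁ * b) + (u₀ * a + v₀ * b)
  distrib = solve-∀

φ⊗mkφ : ∀ a b → φ ⊗ mkφ a b ≡ mkφ b (a + b)
φ⊗mkφ a b = cong₂ mkφ (re-eq a b) (im-eq a b)
  where
  re-eq : ∀ a b → + 0 * a + + 1 * b ≡ b
  re-eq = solve-∀
  im-eq : ∀ a b → + 0 * b + + 1 * a + + 1 * b ≡ a + b
  im-eq = solve-∀

φ⁻¹⊗mkφ : ∀ a b → φ⁻¹ ⊗ mkφ a b ≡ mkφ (b - a) a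
φ⁻¹⊗mkφ a b = cong₂ mkφ (re-eq a b) (im-eq a b)
  where
  re-eq : ∀ a b → - (+ 1) * a + + 1 * b ≡ b - a
  re-eq = solve-∀
  im-eq : ∀ a b → - (+ 1) * b + + 1 * a + + 1 * b ≡ a
  im-eq = solve-∀

φ⊗[φ⁻¹⊗x]≡x : ∀ x → φ ⊗ (φ⁻¹ ⊗ x) ≡ x
φ⊗[φ⁻¹⊗x]≡x (mkφ a b) = begin
  φ ⊗ (φ⁻¹ ⊗ mkφ a b)  ≡⟨ cong (φ ⊗_) (φ⁻¹⊗mkφ a b) ⟩
  φ ⊗ mkφ (b - a) a    ≡⟨ φ⊗mkφ (b - a) a ⟩
  mkφ a (b - a + a)    ≡⟨ cong (mkφ a) (m-n+n≡m b a) ⟩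
  mkφ a b              ∎
  where
  open ≡-Reasoning
  m-n+n≡m : ∀ m n → m - n + n ≡ m
  m-n+n≡m = solve-∀

φ⊗[φ⊗x]≡φ⊗x⊕x : ∀ x → φ ⊗ (φ ⊗ x) ≡ φ ⊗ x ⊕ x
φ⊗[φ⊗x]≡φ⊗x⊕x (mkφ a b) = begin
  φ ⊗ (φ ⊗ mkφ a b)        ≡⟨ cong (φ ⊗_) (φ⊗mkφ a b) ⟩
  φ ⊗ mkφ b (a + b)        ≡⟨ φ⊗mkφ b (a + b) ⟩
  mkφ (a + b) (b + (a + b)) ≡⟨ cong₂ mkφ (+-comm a b) (+-comm b (a + b)) ⟩
  mkφ b (a + b) ⊕ mkφ a b  ≡⟨ cong (_⊕ mkφ a b) (sym (φ⊗mkφ a b)) ⟩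
  φ ⊗ mkφ a b ⊕ mkφ a b    ∎
  where open ≡-Reasoning

φ^-suc : ∀ i → φ^ (sucℤ i) ≡ φ ⊗ φ^ i
φ^-suc (+ k) = refl
φ^-suc -[1+ zero ] = sym (φ⊗[φ⁻¹⊗x]≡x one)
φ^-suc -[1+ suc k ] = sym (φ⊗[φ⁻¹⊗x]≡x (φ^ -[1+ k ]))

φ^-recurrence : ∀ i → φ^ (sucℤ (sucℤ i)) ≡ φ^ (sucℤ i) ⊕ φ^ i
φ^-recurrence i = begin
  φ^ (sucℤ (sucℤ i))  ≡⟨ φ^-suc (sucℤ i) ⟩
  φ ⊗ φ^ (sucℤ i)     ≡⟨ cong (φ ⊗_) (φ^-suc i) ⟩
  φ ⊗ (φ ⊗ φ^ i)      ≡⟨ φ⊗[φ⊗x]≡φ⊗x⊕x (φ^ i) ⟩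
  φ ⊗ φ^ i ⊕ φ^ i     ≡⟨ cong (_⊕ φ^ i) (sym (φ^-suc i)) ⟩
  φ^ (sucℤ i) ⊕ φ^ i  ∎
  where open ≡-Reasoning

re∘φ^-recurrent : Recurrent (λ i → re (φ^ i))
re∘φ^-recurrent i = cong re (φ^-recurrence i)

im∘φ^-recurrent : Recurrent (λ i → im (φ^ i))
im∘φ^-recurrent i = cong im (φ^-recurrence i)

addition-formula : ∀ {X} → Recurrent X → ∀ n i → X (n + i) ≡ re (φ^ i) * X n + im (φ^ i) * X (sucℤ n)
addition-formula {X} rec n =
  recurrent-unique {Y = λ i → re (φ^ i) * X n + im (φ^ i) * X (sucℤ n)} (shift-recurrent {X} rec n)
  (linear-recurrent {λ i → re (φ^ i)} {λ i → im (φ^ i)} re∘φ^-recurrent im∘φ^-recurrent (X n) (X (sucℤ n)))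
  (trans (cong X (+-identityʳ n)) (initial₀ (X n) (X (sucℤ n))))
  (trans (cong X (+-comm n (+ 1))) (initial₁ (X n) (X (sucℤ n))))
  where
  initial₀ : ∀ x y → x ≡ + 1 * x + + 0 * y
  initial₀ = solve-∀
  initial₁ : ∀ x y → y ≡ + 0 * x + + 1 * y
  initial₁ = solve-∀

shiftSum : (ℤ → ℤ) → List ℤ → ℤ → ℤ
shiftSum X is n = sumℤ (map (λ i → X (n + i)) is)

shiftSum-addition-formula : ∀ {X} → Recurrent X → ∀ is n →
  shiftSum X is n ≡ re (sumφ (map φ^ is)) * X n + im (sumφ (map φ^ is)) * X (sucℤ n)
shiftSum-addition-formula {X} rec [] n = zero-combination (X n) (X (sucℤ n))
  where
  zero-combination : ∀ x y → + 0 ≡ + 0 * x + + 0 * y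
  zero-combination = solve-∀
shiftSum-addition-formula {X} rec (i ∷ is) n =
  trans (cong₂ _+_ (addition-formula rec n i) (shiftSum-addition-formula rec is n))
        (collect (re (φ^ i)) (im (φ^ i)) (re s) (im s) (X n) (X (sucℤ n)))
  where
  s = sumφ (map φ^ is)
  collect : ∀ a b c d x y → (a * x + b * y) + (c * x + d * y) ≡ (a + c) * x + (b + d) * y
  collect = solve-∀

coefficients-unique : ∀ {a b c} x₀ x₁ x₂ .{{_ : NonZeroℤ (x₀ * x₂ - x₁ * x₁)}} →
  c * x₀ ≡ a * x₀ + b * x₁ → c * x₁ ≡ a * x₁ + b * x₂ → a ≡ c × b ≡ + 0
coefficients-unique {a} {b} {c} x₀ x₁ x₂ e₀ e₁ =
  *-cancelʳ-≡ a c d a≈c , *-cancelʳ-≡ b (+ 0) d b≈0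
  where
  open ≡-Reasoning
  d = x₀ * x₂ - x₁ * x₁
  -- Cramer's rule: d times each unknown coefficient is a combination of the two equations.
  cramer-a : ∀ a b c x₀ x₁ x₂ → a * (x₀ * x₂ - x₁ * x₁) ≡
    c * (x₀ * x₂ - x₁ * x₁) + (x₂ * ((a * x₀ + b * x₁) - c * x₀) - x₁ * ((a * x₁ + b * x₂) - c * x₁))
  cramer-a = solve-∀
  cramer-b : ∀ a b c x₀ x₁ x₂ → b * (x₀ * x₂ - x₁ * x₁) ≡
    + 0 * (x₀ * x₂ - x₁ * x₁) + (x₀ * ((a * x₁ + b * x₂) - c * x₁) - x₁ * ((a * x₀ + b * x₁) - c * x₀))
  cramer-b = solve-∀
  drop-vanishing : ∀ e x y u v → e + (x * (u - u) - y * (v - v)) ≡ e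
  drop-vanishing = solve-∀
  a≈c : a * d ≡ c * d
  a≈c = begin
    a * d  ≡⟨ cramer-a a b c x₀ x₁ x₂ ⟩
    c * d + (x₂ * ((a * x₀ + b * x₁) - c * x₀) - x₁ * ((a * x₁ + b * x₂) - c * x₁))
           ≡⟨ cong₂ (λ p q → c * d + (x₂ * (p - c * x₀) - x₁ * (q - c * x₁))) (sym e₀) (sym e₁) ⟩
    c * d + (x₂ * (c * x₀ - c * x₀) - x₁ * (c * x₁ - c * x₁))
           ≡⟨ drop-vanishing (c * d) x₂ x₁ (c * x₀) (c * x₁) ⟩
    c * d  ∎
  b≈0 : b * d ≡ + 0 * d
  b≈0 = begin
    b * d  ≡⟨ cramer-b a b c x₀ x₁ x₂ ⟩
    + 0 * d + (x₀ * ((a * x₁ + b * x₂) - c * x₁) - x₁ * ((a * x₀ + b * x₁) - c * x₀))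
           ≡⟨ cong₂ (λ p q → + 0 * d + (x₀ * (p - c * x₁) - x₁ * (q - c * x₀))) (sym e₁) (sym e₀) ⟩
    + 0 * d + (x₀ * (c * x₁ - c * x₁) - x₁ * (c * x₀ - c * x₀))
           ≡⟨ drop-vanishing (+ 0 * d) x₀ x₁ (c * x₁) (c * x₀) ⟩
    + 0 * d  ∎

φ-sum⇒shiftSum : ∀ {X} → Recurrent X → ∀ c is →
  ι c ≡ sumφ (map φ^ is) → ∀ n → c * X n ≡ shiftSum X is n
φ-sum⇒shiftSum {X} rec c is e n = sym (begin
  shiftSum X is n                  ≡⟨ shiftSum-addition-formula rec is n ⟩
  re s * X n + im s * X (sucℤ n)   ≡⟨ cong₂ (λ a b → a * X n + b * X (sucℤ n)) (sym (cong re e)) (sym (cong im e)) ⟩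
  c * X n + + 0 * X (sucℤ n)       ≡⟨ drop-zero c (X n) (X (sucℤ n)) ⟩
  c * X n                          ∎)
  where
  open ≡-Reasoning
  s = sumφ (map φ^ is)
  drop-zero : ∀ c x y → c * x + + 0 * y ≡ c * x
  drop-zero = solve-∀

shiftSum⇒φ-sum : ∀ {X} → Recurrent X → .{{_ : NonZeroℤ (X (+ 0) * X (+ 2) - X (+ 1) * X (+ 1))}} →
  ∀ c is → (∀ n → c * X n ≡ shiftSum X is n) → ι c ≡ sumφ (map φ^ is)
shiftSum⇒φ-sum {X} rec c is h with coefficients-unique (X (+ 0)) (X (+ 1)) (X (+ 2))
  (trans (h (+ 0)) (shiftSum-addition-formula {X} rec is (+ 0)))
  (trans (h (+ 1)) (shiftSum-addition-formula {X} rec is (+ 1)))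
... | re≡c , im≡0 = cong₂ mkφ (sym re≡c) (sym im≡0)

F-recurrent : Recurrent F
F-recurrent = recSeq-recurrent (+ 0) (+ 1)

L-recurrent : Recurrent L
L-recurrent = recSeq-recurrent (+ 2) (+ 1)

proposition1 : (N : ℕ) → .{{_ : NonZero N}} → (is : List ℤ) →
    (((n : ℤ) → (+ N) * F n ≡ sumℤ (map (λ i → F (n + i)) is))
      ⇔ (ι (+ N) ≡ sumφ (map φ^ is)))
    × ((ι (+ N) ≡ sumφ (map φ^ is))
      ⇔ ((n : ℤ) → (+ N) * L n ≡ sumℤ (map (λ i → L (n + i)) is)))
proposition1 N is =
  mk⇔ (shiftSum⇒φ-sum F-recurrent (+ N) is) (φ-sum⇒shiftSum F-recurrent (+ N) is) ,
  mk⇔ (φ-sum⇒shiftSum L-recurrent (+ N) is) (shiftSum⇒φ-sum L-recurrent (+ N) is)
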